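{- Let $G$ be a connected chordal graph and let $r=r_0,\dots,r_{|r|-1}$ be a separator path in $G$. Then for every $0\le i<|r|-2$, the vertices $r_i$ and $r_{i+2}$ are adjacent.
   Context: A chordal graph is a simple undirected graph in which every cycle with four or more vertices has a chord. A path is a sequence of vertices with consecutive vertices adjacent; $|r|$ is its number of vertices; it is simple if its vertices are distinct; $p_{i,j}$ is the subpath $p_i,\dots,p_j$ and $p$ contains $q$ if $q=p_{i,j}$ for some $i\le j$. A path is separating if removing all of its edges from $G$ disconnects $G$. A separator path is a simple separating path that does not contain any separating path other than itself. -}

module Defs where

open import Data.Nat using (ℕ; zero; suc; _≤_; _<_; _∸_)
open import Data.Fin using (Fin; toℕ)
open import Data.Bool using (Bool; T)
open import Data.List using (List; []; _∷_; length; lookup; take; drop)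
open import Data.List.Relation.Unary.Unique.Propositional using (Unique)
open import Data.Product using (Σ; _×_; ∃; ∃-syntax)
open import Relation.Nullary using (¬_)
open import Relation.Binary.PropositionalEquality using (_≡_)

record Graph : Set where
  field
    n      : ℕ
    adj    : Fin n → Fin n → Bool
    sym    : ∀ u v → adj u v ≡ adj v u
    irrefl : ∀ u → adj u u ≡ Data.Bool.false

open Graph public

module _ (G : Graph) where

  V : Set
  V = Fin (n G)

  Adj : V → V → Set
  Adj u v = T (adj G u v)

  data IsPath : List V → Set where
    single : ∀ v → IsPath (v ∷ [])
    cons   : ∀ u v rest → Adj u v → IsPath (v ∷ rest) → IsPath (u ∷ v ∷ rest)

  data PathEdge : List V → V → V → Set where
    here-fwd : ∀ u v rest → PathEdge (u ∷ v ∷ rest) u v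
    here-bwd : ∀ u v rest → PathEdge (u ∷ v ∷ rest) v u
    there    : ∀ w rest u v → PathEdge rest u v → PathEdge (w ∷ rest) u v

  data Walk (E : V → V → Set) : V → V → Set where
    here : ∀ u → Walk E u u
    step : ∀ u w v → E u w → Walk E w v → Walk E u v

  Connected : Set
  Connected = ∀ u v → Walk Adj u v

  AdjWithout : List V → V → V → Set
  AdjWithout p u v = Adj u v × ¬ PathEdge p u v

  Separating : List V → Set
  Separating p = IsPath p × ¬ (∀ u v → Walk (AdjWithout p) u v)

  Contains : List V → List V → Set
  Contains p q = ∃[ i ] ∃[ j ] (i ≤ j × j < length p × q ≡ take (suc j ∸ i) (drop i p))

  SeparatorPath : List V → Set
  SeparatorPath r = Unique r × Separating r × (∀ q → Contains r q → Separating q → q ≡ r)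

  -- i, j (i < j) are positions on the cycle c that are not consecutive on the cycle
  NonConsecutive : (c : List V) → Fin (length c) → Fin (length c) → Set
  NonConsecutive c i j = suc (toℕ i) < toℕ j × ¬ (toℕ i ≡ 0 × suc (toℕ j) ≡ length c)

  Chordal : Set
  Chordal = ∀ (c : List V) → 4 ≤ length c → Unique c → IsPath c →
            (∀ (i j : Fin (length c)) → toℕ i ≡ 0 → suc (toℕ j) ≡ length c →
               Adj (lookup c j) (lookup c i)) →
            ∃[ i ] ∃[ j ] (NonConsecutive c i j × Adj (lookup c i) (lookup c j))

-- Let H be G with the edges of r removed.  Since neither the tail r₁ … of r nor
-- r without its last vertex separates G, H has exactly two components, r₀ and r₁
-- lie in different ones, and so do the last two vertices of r.  Consecutive
-- vertices of r alternate between the components: if r_{a+1}, r_{a+2} lay on the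
-- side opposite to r_a, some later vertex r_p of r would be back on the side of
-- r_a; a walk from r_p to r_a inside H, extended backwards along r to the last
-- r_k (k ≥ a+2) adjacent to r_{a+1}, meets no other neighbour of r_{a+1}.  In a
-- chordal graph this forces the edge r_k r_a (close a shortest such path into a
-- cycle through r_{a+1}: any chord it has shortens it), but an edge between the two
-- components must be an edge of r.  So r_i and r_{i+2} share a component, and the
-- same chordality argument applies to a walk between them in H.
module Submission where

open import Data.Nat using (ℕ; zero; suc; _+_; _≤_; _<_; z≤n; s≤s)
open import Data.Nat.Properties
  using ( ≤-refl; ≤-reflexive; ≤-trans; ≤-pred; m≤n⇒m≤1+n; n<1+n; <⇒≢; ≤∧≢⇒<; ≤∧≮⇒≡
        ; _<?_; m≢1+m+n; m≤m+n; +-identityʳ; +-suc; +-comm; +-monoʳ-≤; m⊓n≤m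
        ; m≤n⇒∃[o]m+o≡n; suc-injective)
open import Data.Bool using (T)
open import Data.Bool.Properties using (T?)
open import Data.Fin using (Fin; toℕ; zero; suc)
import Data.Fin.Properties as Fin
open import Data.List using (List; []; _∷_; length; lookup; take)
open import Data.List.Properties using (length-take; take-all)
open import Data.List.Membership.Propositional using (_∈_)
import Data.List.Membership.DecPropositional as DecMembership
open import Data.List.Relation.Unary.Any using (here; there)
open import Data.List.Relation.Unary.All as All using (All; []; _∷_)
open import Data.List.Relation.Unary.All.Properties using (anti-mono; ¬Any⇒All¬)
open import Data.List.Relation.Unary.AllPairs using ([]; _∷_)
open import Data.List.Relation.Unary.Unique.Propositional using (Unique)
open import Data.List.Relation.Binary.Subset.Propositional using (_⊆_)
open import Data.List.Relation.Binary.Subset.Propositional.Properties using (⊆-refl; ∷⁺ʳ; ∈-∷⁺ʳ)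
open import Data.Product using (∃; ∃₂; ∃-syntax; _×_; _,_; proj₁; proj₂; map₁; map₂; swap)
open import Data.Sum using (_⊎_; inj₁; inj₂; [_,_]′) renaming (map to ⊎-map)
open import Data.Empty using (⊥; ⊥-elim)
open import Function using (_∘_)
open import Relation.Nullary using (¬_; Dec; yes; no; contradiction)
open import Relation.Nullary.Decidable using (map′; _×-dec_; _⊎-dec_; decidable-stable)
open import Relation.Binary.PropositionalEquality as ≡ using (_≡_; _≢_; refl; subst; subst₂; cong)

open import Defs

infix 4 _[_]=_

data _[_]=_ {A : Set} : List A → ℕ → A → Set where
  here  : ∀ {x xs} → x ∷ xs [ 0 ]= x
  there : ∀ {x y xs i} → xs [ i ]= y → x ∷ xs [ suc i ]= y

module _ {A : Set} where

  []=-functional : ∀ {xs i} {x y : A} → xs [ i ]= x → xs [ i ]= y → x ≡ y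
  []=-functional here      here      = refl
  []=-functional (there p) (there q) = []=-functional p q

  []=⇒∈ : ∀ {xs i} {x : A} → xs [ i ]= x → x ∈ xs
  []=⇒∈ here      = here refl
  []=⇒∈ (there p) = there ([]=⇒∈ p)

  []=-injective : ∀ {xs i j} {x : A} → Unique xs → xs [ i ]= x → xs [ j ]= x → i ≡ j
  []=-injective _         here      here      = refl
  []=-injective (x∉ ∷ _)  here      (there q) = contradiction refl (All.lookup x∉ ([]=⇒∈ q))
  []=-injective (x∉ ∷ _)  (there p) here      = contradiction refl (All.lookup x∉ ([]=⇒∈ p))
  []=-injective (_ ∷ un)  (there p) (there q) = cong suc ([]=-injective un p q)

  []=⇒< : ∀ {xs i} {x : A} → xs [ i ]= x → i < length xs
  []=⇒< here      = s≤s z≤n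
  []=⇒< (there p) = s≤s ([]=⇒< p)

  <⇒[]= : ∀ xs {i} → i < length xs → ∃ λ (x : A) → xs [ i ]= x
  <⇒[]= (x ∷ xs) {zero}  _       = x , here
  <⇒[]= (x ∷ xs) {suc i} (s≤s i<) = map₂ there (<⇒[]= xs i<)

  []=-previous : ∀ {xs i} {x : A} → xs [ suc i ]= x → ∃ λ y → xs [ i ]= y
  []=-previous (there here)      = _ , here
  []=-previous (there (there p)) = map₂ there ([]=-previous (there p))

  lookup⇒[]= : ∀ (xs : List A) (i : Fin (length xs)) → xs [ toℕ i ]= lookup xs i
  lookup⇒[]= (x ∷ xs) zero    = here
  lookup⇒[]= (x ∷ xs) (suc i) = there (lookup⇒[]= xs i)

  []=-take : ∀ {xs i n} {x : A} → xs [ i ]= x → i < n → take n xs [ i ]= x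
  []=-take here      (s≤s _)  = here
  []=-take (there p) (s≤s i<) = there ([]=-take p i<)

module GraphProperties (G : Graph) where

  open DecMembership (Fin._≟_ {n G}) using (_∈?_)

  adj-sym : ∀ {u v} → Adj G u v → Adj G v u
  adj-sym {u} {v} = subst T (Graph.sym G u v)

  adj-irrefl : ∀ {u} → ¬ Adj G u u
  adj-irrefl {u} = subst T (irrefl G u)

  adj? : ∀ u v → Dec (Adj G u v)
  adj? u v = T? (adj G u v)

  N[_] : V G → V G → Set
  N[ y ] t = y ≡ t ⊎ Adj G y t

  Into : (V G → Set) → V G → V G → Set
  Into S a b = Adj G a b × S b

  module _ {E : V G → V G → Set} where

    infixr 5 _◅◅_

    _◅◅_ : ∀ {u w v} → Walk G E u w → Walk G E w v → Walk G E u v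
    here _         ◅◅ q = q
    step u w _ e p ◅◅ q = step u w _ e (p ◅◅ q)

    reverse : (∀ {a b} → E a b → E b a) → ∀ {u v} → Walk G E u v → Walk G E v u
    reverse sym (here u)         = here u
    reverse sym (step u w v e p) = reverse sym p ◅◅ step w u u (sym e) (here u)

    walk-map : ∀ {E′} → (∀ {a b} → E a b → E′ a b) → ∀ {u v} → Walk G E u v → Walk G E′ u v
    walk-map f (here u)         = here u
    walk-map f (step u w v e p) = step u w v (f e) (walk-map f p)

    restrict : ∀ {P : V G → Set} → (∀ {a b} → E a b → P a → P b) →
               ∀ {u v} → P u → Walk G E u v → Walk G (λ a b → E a b × P b) u v
    restrict keep pu (here u)         = here u
    restrict keep pu (step u w v e p) = step u w v (e , keep e pu) (restrict keep (keep e pu) p)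

  walk-bind : ∀ {E E′ : V G → V G → Set} → (∀ {a b} → E a b → Walk G E′ a b) →
              ∀ {u v} → Walk G E u v → Walk G E′ u v
  walk-bind f (here u)         = here u
  walk-bind f (step u w v e p) = f e ◅◅ walk-bind f p

  _⊆_∪⟨_—_⟩ : (E′ E : V G → V G → Set) → V G → V G → Set
  E′ ⊆ E ∪⟨ s — t ⟩ = ∀ {a b} → E′ a b → E a b ⊎ a ≡ s × b ≡ t ⊎ a ≡ t × b ≡ s

  module _ {E E′ : V G → V G → Set} {s t : V G} (E′⊆ : E′ ⊆ E ∪⟨ s — t ⟩) where

    ∪-connected : (∀ {a b} → E a b → E b a) → Walk G E s t →
                  (∀ u v → Walk G E′ u v) → ∀ u v → Walk G E u v
    ∪-connected sym s~t connected u v = walk-bind edge (connected u v)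
      where
      edge : ∀ {a b} → E′ a b → Walk G E a b
      edge e with E′⊆ e
      ... | inj₁ e′                   = step _ _ _ e′ (here _)
      ... | inj₂ (inj₁ (refl , refl)) = s~t
      ... | inj₂ (inj₂ (refl , refl)) = reverse sym s~t

    ∪-sides : ∀ {a v} → Walk G E′ a v → Walk G E s a ⊎ Walk G E t a → Walk G E s v ⊎ Walk G E t v
    ∪-sides (here _)         side = side
    ∪-sides (step a b v e p) side with E′⊆ e
    ... | inj₁ e′                   = ∪-sides p (⊎-map (_◅◅ e′-walk) (_◅◅ e′-walk) side)
      where e′-walk = step a b b e′ (here b)
    ... | inj₂ (inj₁ (refl , refl)) = ∪-sides p (inj₂ (here _))
    ... | inj₂ (inj₂ (refl , refl)) = ∪-sides p (inj₁ (here _))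

  pathEdge-sym : ∀ {p u v} → PathEdge G p u v → PathEdge G p v u
  pathEdge-sym (here-fwd u v rest)  = here-bwd u v rest
  pathEdge-sym (here-bwd u v rest)  = here-fwd u v rest
  pathEdge-sym (there w rest u v q) = there w rest v u (pathEdge-sym q)

  pathEdge? : ∀ p u v → Dec (PathEdge G p u v)
  pathEdge? []           u v = no λ ()
  pathEdge? (w ∷ [])     u v = no λ { (there _ _ _ _ ()) }
  pathEdge? (w ∷ w′ ∷ p) u v =
    map′ to from (((w Fin.≟ u) ×-dec (w′ Fin.≟ v)) ⊎-dec ((w′ Fin.≟ u) ×-dec (w Fin.≟ v))
                  ⊎-dec pathEdge? (w′ ∷ p) u v)
    where
    to : w ≡ u × w′ ≡ v ⊎ w′ ≡ u × w ≡ v ⊎ PathEdge G (w′ ∷ p) u v → PathEdge G (w ∷ w′ ∷ p) u v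
    to (inj₁ (refl , refl))        = here-fwd w w′ p
    to (inj₂ (inj₁ (refl , refl))) = here-bwd w w′ p
    to (inj₂ (inj₂ q))             = there w (w′ ∷ p) u v q
    from : PathEdge G (w ∷ w′ ∷ p) u v → w ≡ u × w′ ≡ v ⊎ w′ ≡ u × w ≡ v ⊎ PathEdge G (w′ ∷ p) u v
    from (here-fwd _ _ _)   = inj₁ (refl , refl)
    from (here-bwd _ _ _)   = inj₂ (inj₁ (refl , refl))
    from (there _ _ _ _ q)  = inj₂ (inj₂ q)

  pathEdge⇒[]= : ∀ {p u v} → PathEdge G p u v →
                 ∃[ m ] (p [ m ]= u × p [ suc m ]= v ⊎ p [ suc m ]= u × p [ m ]= v)
  pathEdge⇒[]= (here-fwd u v rest)  = 0 , inj₁ (here , there here)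
  pathEdge⇒[]= (here-bwd u v rest)  = 0 , inj₂ (there here , here)
  pathEdge⇒[]= (there w rest u v q) with pathEdge⇒[]= q
  ... | m , inj₁ (u∈ , v∈) = suc m , inj₁ (there u∈ , there v∈)
  ... | m , inj₂ (u∈ , v∈) = suc m , inj₂ (there u∈ , there v∈)

  []=⇒pathEdge : ∀ {p m u v} → p [ m ]= u → p [ suc m ]= v → PathEdge G p u v
  []=⇒pathEdge here      (there here) = here-fwd _ _ _
  []=⇒pathEdge (there a) (there b)    = there _ _ _ _ ([]=⇒pathEdge a b)

  pathEdge-neighbour : ∀ {p i s t} → Unique p → PathEdge G p s t → p [ i ]= s →
                       p [ suc i ]= t ⊎ ∃[ j ] (i ≡ suc j × p [ j ]= t)
  pathEdge-neighbour un pe s∈ with pathEdge⇒[]= pe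
  ... | m , inj₁ (s∈′ , t∈) with []=-injective un s∈ s∈′
  ...   | refl = inj₁ t∈
  pathEdge-neighbour un pe s∈ | m , inj₂ (s∈′ , t∈) with []=-injective un s∈ s∈′
  ...   | refl = inj₂ (m , refl , t∈)

  isPath⇒adj : ∀ {p m u v} → IsPath G p → p [ m ]= u → p [ suc m ]= v → Adj G u v
  isPath⇒adj (cons _ _ _ e _) here      (there here) = e
  isPath⇒adj (cons _ _ _ _ p) (there a) (there b)    = isPath⇒adj p a b

  take-isPath : ∀ m {p} → IsPath G p → IsPath G (take (suc m) p)
  take-isPath zero    (single v)       = single v
  take-isPath (suc m) (single v)       = single v
  take-isPath zero    (cons u _ _ _ _) = single u
  take-isPath (suc m) (cons u v _ e p) = cons u v _ e (take-isPath m p)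

  data Joins : List (V G) → V G → V G → Set where
    [_]    : ∀ v → Joins (v ∷ []) v v
    _∷⟨_⟩_ : ∀ u {v z w} → Adj G u v → Joins w v z → Joins (u ∷ w) u z

  joins⇒isPath : ∀ {w x z} → Joins w x z → IsPath G w
  joins⇒isPath [ v ]                      = single v
  joins⇒isPath (u ∷⟨ e ⟩ [ v ])           = cons u v [] e (single v)
  joins⇒isPath (u ∷⟨ e ⟩ p@(v ∷⟨ _ ⟩ _)) = cons u v _ e (joins⇒isPath p)

  joins-nonempty : ∀ {w x z} → Joins w x z → 1 ≤ length w
  joins-nonempty [ _ ]         = s≤s z≤n
  joins-nonempty (_ ∷⟨ _ ⟩ _) = s≤s z≤n

  joins-last : ∀ {u w x z} → Joins (u ∷ w) x z → u ∷ w [ length w ]= z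
  joins-last [ _ ]                     = here
  joins-last (_ ∷⟨ _ ⟩ p@([ _ ]))      = there (joins-last p)
  joins-last (_ ∷⟨ _ ⟩ p@(_ ∷⟨ _ ⟩ _)) = there (joins-last p)

  walk⇒joins : ∀ {S x z} → S x → Walk G (Into S) x z → ∃ λ w → Joins w x z × All S w
  walk⇒joins sx (here x)                = _ , [ x ] , sx ∷ []
  walk⇒joins sx (step x _ _ (e , sy) p) =
    let w , q , all = walk⇒joins sy p in x ∷ w , x ∷⟨ e ⟩ q , sx ∷ all

  suffix : ∀ {w x z u} → Joins w x z → Unique w → u ∈ w →
           ∃ λ s → Joins s u z × Unique s × s ⊆ w × length s ≤ length w
  suffix p@([ _ ])       un (here refl) = _ , p , un , ⊆-refl , ≤-refl
  suffix p@(_ ∷⟨ _ ⟩ _)  un (here refl) = _ , p , un , ⊆-refl , ≤-refl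
  suffix (_ ∷⟨ _ ⟩ p) (_ ∷ un) (there u∈) =
    let s , ps , us , s⊆ , len = suffix p un u∈ in s , ps , us , there ∘ s⊆ , m≤n⇒m≤1+n len

  simplify : ∀ {w x z} → Joins w x z → ∃ λ w′ → Joins w′ x z × Unique w′ × w′ ⊆ w × length w′ ≤ length w
  simplify [ v ] = _ , [ v ] , [] ∷ [] , ⊆-refl , ≤-refl
  simplify (u ∷⟨ e ⟩ p) with simplify p
  ... | w′ , p′ , un , w′⊆ , len with u ∈? w′
  ...   | yes u∈ = let s , ps , us , s⊆ , len′ = suffix p′ un u∈
                   in s , ps , us , there ∘ w′⊆ ∘ s⊆ , m≤n⇒m≤1+n (≤-trans len′ len)
  ...   | no u∉  = _ , u ∷⟨ e ⟩ p′ , ¬Any⇒All¬ w′ u∉ ∷ un , ∷⁺ʳ u w′⊆ , s≤s len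

  suffix-at : ∀ {w x z j v} → Joins w x z → w [ j ]= v → ∃ λ s → Joins s v z × s ⊆ w × length s + j ≡ length w
  suffix-at p@([ _ ])      here       = _ , p , ⊆-refl , +-identityʳ _
  suffix-at p@(_ ∷⟨ _ ⟩ _) here       = _ , p , ⊆-refl , +-identityʳ _
  suffix-at (_ ∷⟨ _ ⟩ p)   (there v∈) =
    let s , ps , s⊆ , len = suffix-at p v∈ in s , ps , there ∘ s⊆ , ≡.trans (+-suc _ _) (cong suc len)

  shortcut : ∀ {w x z i j u v} → Joins w x z → w [ i ]= u → w [ j ]= v → suc i < j → Adj G u v →
             ∃ λ w′ → Joins w′ x z × w′ ⊆ w × length w′ < length w
  shortcut p@(x ∷⟨ _ ⟩ _) here v∈ 1<j x-v =
    let s , ps , s⊆ , len = suffix-at p v∈ in x ∷ s , x ∷⟨ x-v ⟩ ps , ∈-∷⁺ʳ (here refl) s⊆ , shorter len 1<j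
    where
    shorter : ∀ {s j n} → s + j ≡ n → 1 < j → suc s < n
    shorter {s} {j} refl 1<j = subst (_≤ s + j) (+-comm s 2) (+-monoʳ-≤ s 1<j)
  shortcut [ _ ] here (there ()) _ _
  shortcut (x ∷⟨ e ⟩ p) (there u∈) (there v∈) (s≤s i<j) u-v =
    let w′ , p′ , w′⊆ , len = shortcut p u∈ v∈ i<j u-v in x ∷ w′ , x ∷⟨ e ⟩ p′ , ∷⁺ʳ x w′⊆ , s≤s len

  ¬¬-proper-subpath-connected : ∀ {r q} → SeparatorPath G r → Contains G r q → IsPath G q → q ≢ r →
                                ¬ ¬ (∀ u v → Walk G (AdjWithout G q) u v)
  ¬¬-proper-subpath-connected (_ , _ , minimal) r⊇q q-path q≢r disconnected =
    q≢r (minimal _ r⊇q (q-path , disconnected))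

  ¬¬-tail-connected : ∀ {r₀ r₁ rest} → SeparatorPath G (r₀ ∷ r₁ ∷ rest) →
                      ¬ ¬ (∀ u v → Walk G (AdjWithout G (r₁ ∷ rest)) u v)
  ¬¬-tail-connected {rest = rest} sep@(_ , (cons _ _ _ _ tail-path , _) , _) =
    ¬¬-proper-subpath-connected sep
      (1 , suc (length rest) , s≤s z≤n , n<1+n _ , ≡.sym (take-all _ (_ ∷ rest) ≤-refl))
      tail-path
      (<⇒≢ (n<1+n _) ∘ cong length)

  ¬¬-init-connected : ∀ {r₀ r₁ rest} → SeparatorPath G (r₀ ∷ r₁ ∷ rest) →
                      ¬ ¬ (∀ u v → Walk G (AdjWithout G (take (suc (length rest)) (r₀ ∷ r₁ ∷ rest))) u v)
  ¬¬-init-connected {r₀} {r₁} {rest} sep@(_ , (r-path , _) , _) =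
    ¬¬-proper-subpath-connected sep
      (0 , length rest , z≤n , m≤n⇒m≤1+n (n<1+n _) , refl)
      (take-isPath (length rest) r-path)
      (<⇒≢ (s≤s (≤-trans (≤-reflexive (length-take (suc (length rest)) r)) (m⊓n≤m _ _)))
        ∘ cong length)
    where
    r = r₀ ∷ r₁ ∷ rest

module ChordalProperties (G : Graph) (chordal : Chordal G) where

  open GraphProperties G

  Avoid : V G → V G → V G → V G → Set
  Avoid y x z t = t ≡ x ⊎ t ≡ z ⊎ ¬ N[ y ] t

  module _ {x y z : V G} (y-x : Adj G y x) (y-z : Adj G y z) where

    private
      Shorter : ℕ → Set
      Shorter n = ∃ λ w′ → Joins w′ x z × All (Avoid y x z) w′ × length w′ < n

    avoid⇒≢ : ∀ {t} → Avoid y x z t → y ≢ t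
    avoid⇒≢ (inj₁ refl)         refl = adj-irrefl y-x
    avoid⇒≢ (inj₂ (inj₁ refl))  refl = adj-irrefl y-z
    avoid⇒≢ (inj₂ (inj₂ t∉N))  y≡t  = t∉N (inj₁ y≡t)

    -- A chord of the cycle y, x, …, z at y would join y to an inner vertex of
    -- the path, which Avoid forbids; any other chord short-cuts the path.
    chord⇒shorter : ∀ {w} → Joins (x ∷ w) x z → Unique (x ∷ w) → All (Avoid y x z) (x ∷ w) →
                    ∀ {a b u v} → y ∷ x ∷ w [ a ]= u → y ∷ x ∷ w [ b ]= v → suc a < b →
                    ¬ (a ≡ 0 × suc b ≡ length (y ∷ x ∷ w)) → Adj G u v → Shorter (length (x ∷ w))
    chord⇒shorter p un av here (there v∈) (s≤s (s≤s _)) not-closing y-v with All.lookup av ([]=⇒∈ v∈)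
    ... | inj₁ refl with []=-injective un v∈ here
    ...   | ()
    chord⇒shorter p un av here (there v∈) _ not-closing y-v | inj₂ (inj₁ refl) =
      ⊥-elim (not-closing (refl , cong (λ k → suc (suc k)) ([]=-injective un v∈ (joins-last p))))
    chord⇒shorter p un av here (there v∈) _ not-closing y-v | inj₂ (inj₂ v∉N) =
      ⊥-elim (v∉N (inj₂ y-v))
    chord⇒shorter p un av (there u∈) (there v∈) (s≤s i<j) _ u-v =
      let w′ , p′ , w′⊆ , len = shortcut p u∈ v∈ i<j u-v in w′ , p′ , anti-mono w′⊆ av , len

    shorten : ∀ {w} → x ≢ z → ¬ Adj G x z → Joins w x z → Unique w → All (Avoid y x z) w →
              Shorter (length w)
    shorten x≢z _    [ _ ]                  _  _  = ⊥-elim (x≢z refl)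
    shorten _   ¬x-z (_ ∷⟨ x-z ⟩ [ _ ])     _  _  = ⊥-elim (¬x-z x-z)
    shorten {w} _ _ p@(_ ∷⟨ _ ⟩ (_ ∷⟨ _ ⟩ q)) un av
      with chordal (y ∷ w) (s≤s (s≤s (s≤s (joins-nonempty q)))) (All.map avoid⇒≢ av ∷ un)
                   (cons y x _ y-x (joins⇒isPath p)) closing
      where
      closing : ∀ (i j : Fin (length (y ∷ w))) → toℕ i ≡ 0 → suc (toℕ j) ≡ length (y ∷ w) →
                Adj G (lookup (y ∷ w) j) (lookup (y ∷ w) i)
      closing i j i≡0 j≡last = subst₂ (Adj G) (≡.sym z≡) (≡.sym y≡) (adj-sym y-z)
        where
        y≡ = []=-functional (subst (λ k → y ∷ w [ k ]= lookup (y ∷ w) i) i≡0 (lookup⇒[]= (y ∷ w) i)) here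
        z≡ = []=-functional (subst (λ k → y ∷ w [ k ]= lookup (y ∷ w) j) (suc-injective j≡last)
                                   (lookup⇒[]= (y ∷ w) j))
                            (there (joins-last p))
    ... | i , j , (i+1<j , not-closing) , e =
      chord⇒shorter p un av (lookup⇒[]= _ i) (lookup⇒[]= _ j) i+1<j not-closing e

    chordal-avoid⇒adj : x ≢ z → Walk G (Into (Avoid y x z)) x z → Adj G x z
    chordal-avoid⇒adj x≢z walk =
      let w , p , av = walk⇒joins (inj₁ refl) walk in go (length w) p av ≤-refl
      where
      go : ∀ n {w} → Joins w x z → All (Avoid y x z) w → length w ≤ n → Adj G x z
      go zero    p _  len = contradiction (≤-trans (joins-nonempty p) len) λ ()
      go (suc n) p av len with adj? x z
      ... | yes x-z = x-z
      ... | no ¬x-z with simplify p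
      ...   | _ , p′ , un , w′⊆ , len′ with shorten x≢z ¬x-z p′ un (anti-mono w′⊆ av)
      ...     | _ , p″ , av″ , len″ = go n p″ av″ (≤-pred (≤-trans len″ (≤-trans len′ len)))

module SeparatorPathProperties
  (G : Graph) (chordal : Chordal G) (r₀ r₁ : V G) (rest : List (V G))
  (unique : Unique (r₀ ∷ r₁ ∷ rest)) (isPath : IsPath G (r₀ ∷ r₁ ∷ rest))
  (separating : ¬ (∀ u v → Walk G (AdjWithout G (r₀ ∷ r₁ ∷ rest)) u v))
  (tail-connected : ∀ u v → Walk G (AdjWithout G (r₁ ∷ rest)) u v)
  (init-connected : ∀ u v → Walk G (AdjWithout G (take (suc (length rest)) (r₀ ∷ r₁ ∷ rest))) u v)
  where

  open GraphProperties G
  open ChordalProperties G chordal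

  r : List (V G)
  r = r₀ ∷ r₁ ∷ rest

  ℓ : ℕ
  ℓ = length rest

  H : V G → V G → Set
  H = AdjWithout G r

  infix 4 _~_
  _~_ : V G → V G → Set
  _~_ = Walk G H

  H-sym : ∀ {a b} → H a b → H b a
  H-sym (e , ¬pe) = adj-sym e , ¬pe ∘ pathEdge-sym

  ~-refl : ∀ {a} → a ~ a
  ~-refl = here _

  ~-sym : ∀ {a b} → a ~ b → b ~ a
  ~-sym = reverse H-sym

  ~-edge : ∀ {a b} → H a b → a ~ b
  ~-edge e = step _ _ _ e (here _)

  ~-join : ∀ {s a b} → s ~ a → s ~ b → a ~ b
  ~-join s~a s~b = ~-sym s~a ◅◅ s~b

  penult∈ : ∃ (r [ ℓ ]=_)
  penult∈ = <⇒[]= r (m≤n⇒m≤1+n (n<1+n ℓ))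

  last∈ : ∃ (r [ suc ℓ ]=_)
  last∈ = <⇒[]= r (n<1+n (suc ℓ))

  penult last : V G
  penult = proj₁ penult∈
  last   = proj₁ last∈

  tail⊆ : AdjWithout G (r₁ ∷ rest) ⊆ H ∪⟨ r₀ — r₁ ⟩
  tail⊆ {a} {b} (e , ¬tail) with pathEdge? r a b
  ... | no ¬pe                  = inj₁ (e , ¬pe)
  ... | yes (here-fwd _ _ _)    = inj₂ (inj₁ (refl , refl))
  ... | yes (here-bwd _ _ _)    = inj₂ (inj₂ (refl , refl))
  ... | yes (there _ _ _ _ pe)  = ⊥-elim (¬tail pe)

  init-misses⇒last : ∀ {m a b} → r [ m ]= a → r [ suc m ]= b →
                     ¬ PathEdge G (take (suc ℓ) r) a b → a ≡ penult × b ≡ last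
  init-misses⇒last {m} a∈ b∈ ¬init with m <? ℓ
  ... | yes m<ℓ = ⊥-elim (¬init ([]=⇒pathEdge ([]=-take a∈ (m≤n⇒m≤1+n m<ℓ)) ([]=-take b∈ (s≤s m<ℓ))))
  ... | no m≮ℓ with ≤∧≮⇒≡ (≤-pred (≤-pred ([]=⇒< b∈))) m≮ℓ
  ...   | refl = []=-functional a∈ (proj₂ penult∈) , []=-functional b∈ (proj₂ last∈)

  init⊆ : AdjWithout G (take (suc ℓ) r) ⊆ H ∪⟨ penult — last ⟩
  init⊆ {a} {b} (e , ¬init) with pathEdge? r a b
  ... | no ¬pe = inj₁ (e , ¬pe)
  ... | yes pe with pathEdge⇒[]= pe
  ...   | _ , inj₁ (a∈ , b∈) = inj₂ (inj₁ (init-misses⇒last a∈ b∈ ¬init))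
  ...   | _ , inj₂ (a∈ , b∈) = inj₂ (inj₂ (swap (init-misses⇒last b∈ a∈ (¬init ∘ pathEdge-sym))))

  r₀≁r₁ : ¬ r₀ ~ r₁
  r₀≁r₁ r₀~r₁ = separating (∪-connected tail⊆ H-sym r₀~r₁ tail-connected)

  penult≁last : ¬ penult ~ last
  penult≁last p~l = separating (∪-connected init⊆ H-sym p~l init-connected)

  side : ∀ v → r₀ ~ v ⊎ r₁ ~ v
  side v = ∪-sides tail⊆ (tail-connected r₀ v) (inj₁ ~-refl)

  ≁∧≁⇒~ : ∀ {a b c} → ¬ a ~ b → ¬ a ~ c → b ~ c
  ≁∧≁⇒~ {a} {b} {c} a≁b a≁c with side a | side b | side c
  ... | _       | inj₁ b′ | inj₁ c′ = ~-join b′ c′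
  ... | _       | inj₂ b′ | inj₂ c′ = ~-join b′ c′
  ... | inj₁ a′ | inj₁ b′ | inj₂ _  = ⊥-elim (a≁b (~-join a′ b′))
  ... | inj₂ a′ | inj₂ b′ | inj₁ _  = ⊥-elim (a≁b (~-join a′ b′))
  ... | inj₁ a′ | inj₂ _  | inj₁ c′ = ⊥-elim (a≁c (~-join a′ c′))
  ... | inj₂ a′ | inj₁ _  | inj₂ c′ = ⊥-elim (a≁c (~-join a′ c′))

  last-two-≁ : ∀ y → ¬ y ~ penult ⊎ ¬ y ~ last
  last-two-≁ y with side y | side penult
  ... | inj₁ y′ | inj₁ p′ = inj₂ λ y~l → penult≁last (~-join (~-join y′ p′) y~l)
  ... | inj₂ y′ | inj₂ p′ = inj₂ λ y~l → penult≁last (~-join (~-join y′ p′) y~l)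
  ... | inj₁ y′ | inj₂ p′ = inj₁ λ y~p → r₀≁r₁ (y′ ◅◅ y~p ◅◅ ~-sym p′)
  ... | inj₂ y′ | inj₁ p′ = inj₁ λ y~p → r₀≁r₁ (p′ ◅◅ ~-sym y~p ◅◅ ~-sym y′)

  cross⇒neighbour : ∀ {i s t} → Adj G s t → ¬ s ~ t → r [ i ]= s →
                    r [ suc i ]= t ⊎ ∃[ j ] (i ≡ suc j × r [ j ]= t)
  cross⇒neighbour {s = s} {t} e s≁t =
    pathEdge-neighbour unique (decidable-stable (pathEdge? r s t) λ ¬pe → s≁t (~-edge (e , ¬pe)))

  off-side : ∀ {b y t} → r [ suc b ]= y → ¬ y ~ t → r [ b ]= t ⊎ r [ suc (suc b) ]= t ⊎ ¬ N[ y ] t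
  off-side {y = y} {t} y∈ y≁t with adj? y t
  ... | no ¬y-t = inj₂ (inj₂ [ (λ { refl → y≁t ~-refl }) , ¬y-t ]′)
  ... | yes y-t with cross⇒neighbour y-t y≁t y∈
  ...   | inj₁ t∈             = inj₂ (inj₁ t∈)
  ...   | inj₂ (_ , refl , t∈) = inj₁ t∈

  walk-off : ∀ {y u v} → ¬ y ~ u → u ~ v → Walk G (Into (λ t → ¬ y ~ t)) u v
  walk-off y≁u = walk-map (map₁ proj₁) ∘ restrict (λ e y≁a y~b → y≁a (y~b ◅◅ ~-edge (H-sym e))) y≁u

  m<2+m+n : ∀ a d → a < suc (suc a) + d
  m<2+m+n a d = s≤s (m≤n⇒m≤1+n (m≤m+n a d))

  beyond : ∀ {a y p u} → r [ suc a ]= y → suc a ≤ p → r [ p ]= u → ¬ y ~ u →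
           ∃[ d ] r [ suc (suc a) + d ]= u
  beyond {a} {y} {u = u} y∈ a<p u∈ y≁u
    with m≤n⇒∃[o]m+o≡n (≤∧≢⇒< a<p λ { refl → y≁u (subst (y ~_) ([]=-functional y∈ u∈) ~-refl) })
  ... | d , refl = d , u∈

  far-off : ∀ {a y v} → r [ suc a ]= y → r [ suc (suc a) ]= v →
            ∃₂ λ d u → r [ suc (suc a) + d ]= u × ¬ y ~ u
  far-off {y = y} y∈ v∈ with last-two-≁ y
  ... | inj₁ y≁p = let d , u∈ = beyond y∈ (≤-pred (≤-pred ([]=⇒< v∈))) (proj₂ penult∈) y≁p
                   in d , penult , u∈ , y≁p
  ... | inj₂ y≁l = let d , u∈ = beyond y∈ (m≤n⇒m≤1+n (≤-pred (≤-pred ([]=⇒< v∈)))) (proj₂ last∈) y≁l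
                   in d , last , u∈ , y≁l

  ≁-step : ∀ {a x y v} → r [ a ]= x → r [ suc a ]= y → r [ suc (suc a) ]= v → ¬ x ~ y → ¬ y ~ v
  ≁-step {a} {x} {y} {v} x∈ y∈ v∈ x≁y y~v with far-off y∈ v∈
  ... | d , u , u∈ , y≁u =
    descend d u∈ (walk-map (map₂ near) (walk-off y≁u (≁∧≁⇒~ y≁u (x≁y ∘ ~-sym))))
    where
    Near : V G → Set
    Near t = t ≡ x ⊎ ¬ N[ y ] t

    near : ∀ {t} → ¬ y ~ t → Near t
    near y≁t with off-side y∈ y≁t
    ... | inj₁ t∈         = inj₁ ([]=-functional t∈ x∈)
    ... | inj₂ (inj₁ t∈)  = ⊥-elim (y≁t (subst (y ~_) ([]=-functional v∈ t∈) y~v))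
    ... | inj₂ (inj₂ t∉N) = inj₂ t∉N

    y~nbr : ∀ {d u} → r [ suc (suc a) + d ]= u → Adj G y u → ¬ ¬ y ~ u
    y~nbr {d} u∈ y-u y≁u with cross⇒neighbour y-u y≁u y∈
    ... | inj₁ v∈′             = y≁u (subst (y ~_) ([]=-functional v∈ v∈′) y~v)
    ... | inj₂ (_ , refl , u∈′) = <⇒≢ (m<2+m+n a d) (≡.sym ([]=-injective unique u∈ u∈′))

    ¬adj-x : ∀ {d u} → r [ suc (suc a) + d ]= u → y ~ u → ¬ Adj G u x
    ¬adj-x {d} u∈ y~u u-x with cross⇒neighbour u-x (λ u~x → x≁y (~-sym (y~u ◅◅ u~x))) u∈
    ... | inj₁ x∈′ = <⇒≢ (m≤n⇒m≤1+n (m<2+m+n a d)) ([]=-injective unique x∈ x∈′)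
    ... | inj₂ (_ , 2+a+d≡1+j , x∈′) with []=-injective unique x∈ x∈′
    ...   | refl = m≢1+m+n a (≡.sym (suc-injective 2+a+d≡1+j))

    -- The walk from u = r_{a+2+d} to x meets N[ y ] at most in x; step back
    -- along r until u is adjacent to y.
    descend : ∀ d {u} → r [ suc (suc a) + d ]= u → Walk G (Into Near) u x → ⊥
    descend d {u} u∈ walk with adj? y u
    ... | yes y-u = y~nbr u∈ y-u λ y~u → ¬adj-x u∈ y~u
                      (chordal-avoid⇒adj y-u (adj-sym (isPath⇒adj isPath x∈ y∈)) u≢x (walk-map (map₂ inj₂) walk))
      where
      u≢x : u ≢ x
      u≢x refl = <⇒≢ (m<2+m+n a d) (≡.sym ([]=-injective unique u∈ x∈))
    descend zero {u} u∈ walk | no ¬y-u =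
      ¬y-u (subst (Adj G y) ([]=-functional v∈ (subst (r [_]= u) (+-identityʳ _) u∈)) (isPath⇒adj isPath y∈ v∈))
    descend (suc d) {u} u∈ walk | no ¬y-u =
      let u∈′ = subst (r [_]= u) (+-suc (suc (suc a)) d) u∈
          u′ , u′∈ = []=-previous u∈′
      in descend d u′∈ (step u′ u x (isPath⇒adj isPath u′∈ u∈′ , inj₂ u∉N) walk)
      where
      u∉N : ¬ N[ y ] u
      u∉N = [ (λ { refl → m≢1+m+n a (suc-injective ([]=-injective unique y∈ u∈)) }) , ¬y-u ]′

  alternating : ∀ a {x y} → r [ a ]= x → r [ suc a ]= y → ¬ x ~ y
  alternating zero    here (there here) = r₀≁r₁
  alternating (suc a) y∈ v∈ = let _ , x∈ = []=-previous y∈ in ≁-step x∈ y∈ v∈ (alternating a x∈ y∈)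

  distance-two-adjacent : ∀ i {x z} → r [ i ]= x → r [ suc (suc i) ]= z → Adj G x z
  distance-two-adjacent i {x} {z} x∈ z∈ =
    chordal-avoid⇒adj (adj-sym (isPath⇒adj isPath x∈ y∈)) (isPath⇒adj isPath y∈ z∈) x≢z
      (walk-map (map₂ avoid) (walk-off y≁x (≁∧≁⇒~ y≁x y≁z)))
    where
    y : V G
    y = proj₁ ([]=-previous z∈)
    y∈ : r [ suc i ]= y
    y∈ = proj₂ ([]=-previous z∈)
    y≁x : ¬ y ~ x
    y≁x = alternating i x∈ y∈ ∘ ~-sym
    y≁z : ¬ y ~ z
    y≁z = alternating (suc i) y∈ z∈
    x≢z : x ≢ z
    x≢z refl = <⇒≢ (m≤n⇒m≤1+n ≤-refl) ([]=-injective unique x∈ z∈)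
    avoid : ∀ {t} → ¬ y ~ t → Avoid y x z t
    avoid y≁t with off-side y∈ y≁t
    ... | inj₁ t∈         = inj₁ ([]=-functional t∈ x∈)
    ... | inj₂ (inj₁ t∈)  = inj₂ (inj₁ ([]=-functional t∈ z∈))
    ... | inj₂ (inj₂ t∉N) = inj₂ (inj₂ t∉N)

theorem6 : (G : Graph) → Connected G → Chordal G →
           (r : List (V G)) → SeparatorPath G r →
           (i j : Fin (length r)) → toℕ j ≡ toℕ i + 2 →
           Adj G (lookup r i) (lookup r j)
theorem6 G _ _ (_ ∷ []) _ zero zero ()
theorem6 G _ chordal r@(r₀ ∷ r₁ ∷ rest) sep@(unique , (isPath , separating) , _) i j j≡i+2 =
  decidable-stable (adj? (lookup r i) (lookup r j)) λ ¬adj →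
  ¬¬-tail-connected sep λ tail-connected →
  ¬¬-init-connected sep λ init-connected →
  ¬adj (SeparatorPathProperties.distance-two-adjacent
          G chordal r₀ r₁ rest unique isPath separating tail-connected init-connected
          (toℕ i) (lookup⇒[]= r i) j∈)
  where
  open GraphProperties G
  j∈ : r [ suc (suc (toℕ i)) ]= lookup r j
  j∈ = subst (r [_]= lookup r j) (≡.trans j≡i+2 (+-comm (toℕ i) 2)) (lookup⇒[]= r j)
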